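{- Let $(\Sigma,\mathcal R)$ be an LCSTRS and $\mathsf{REQS}$ a set of requirements as below, with $\mathcal P_{strong}$ and $\mathcal P_{weak}$ defined from it. Suppose there is a reduction triple $(>,\gtrsim,\geq)$ on terms such that: $\ell\gamma>p\gamma$ for all $(\ell,p,\varphi)\in\mathcal P_{strong}$ and all substitutions $\gamma$ respecting $\varphi$; $\ell\gamma\gtrsim p\gamma$ for all $(\ell,p,\varphi)\in\mathcal P_{weak}$ and all $\gamma$ respecting $\varphi$; and $\ell\gamma\geq r\gamma$ for all $\ell\to r\ [\varphi]\in\mathcal R$ and all $\gamma$ respecting $\varphi$. Then no (infinite) strong chain exists.
   Context: LCSTRSs. Types are built from sorts $\mathcal S$ by $\sigma::=\iota\mid\sigma\to\sigma$; theory sorts $\mathcal S_{theory}\subseteq\mathcal S$ include $\mathsf{bool}$, each with a non-empty interpretation. Signature $\Sigma=\Sigma_{theory}\uplus\Sigma_{terms}$, disjoint typed variables $\mathcal V$ (infinitely many per type); each $f\in\Sigma_{theory}$ has a theory type and interpretation. Terms: well-typed applicative terms $a\,t_1\cdots t_n$ ($a\in\Sigma\cup\mathcal V$). Values $\mathcal{V}\mathit{al}$: symbols of $\Sigma_{theory}$ of sort type, one per element of each $[\![\iota]\!]$. Constraint: theory term of type $\mathsf{bool}$ with theory-sorted variables. Substitutions: type-preserving $\gamma:\mathcal V\to T(\Sigma,\mathcal V)$ extended homomorphically; $\gamma$ respects $\varphi$ if $\gamma(\mathrm{Var}(\varphi))\subseteq\mathcal{V}\mathit{al}$ and $[\![\varphi\gamma]\!]=\top$.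 $s\rhd t$: $t$ is a strict subterm of $s$ (possibly at the head of an application). Contexts: terms with a fresh constant $\square$ occurring once. An LCSTRS has a set $\mathcal R$ of rules $\ell\to r\ [\varphi]$ ($\ell=f\,\ell_1\cdots\ell_k$, $f\in\Sigma$) and calculation rules $f\,x_1\cdots x_m\to y\ [y=f\,x_1\cdots x_m]$ for non-value theory symbols; $C[\ell\gamma]\to_{\mathcal R}C[r\gamma]$ for such rules with $\gamma$ respecting $\varphi$. Reduction triple: a triple $(>,\gtrsim,\geq)$ of relations on terms with $>$ a well-founded strict partial order, $\gtrsim$ a quasi-order such that $s>t\gtrsim u$ implies $s>u$, and $\geq$ a monotonic quasi-order ($s\geq t$ implies $C[s]\geq C[t]$ for all contexts $C$) such that $s\geq t$ implies $s\gtrsim t$. Definitions. $\mathsf{REQS}$ is a set of requirements of the form $\ell\succ r\ [\varphi]$ or $\ell\succeq r\ [\varphi]$ with $\ell=f\,\ell_1\cdots\ell_k$, $f\in\Sigma$, $\varphi$ a constraint. For a set $\mathcal Q$ of triples $(\ell,r,\varphi)$, $s\to^{top}_{\mathcal Q}t$ if there are $(\ell,r,\varphi)\in\mathcal Q$ and $\gamma$ respecting $\varphi$ with $s=\ell\gamma$, $t=r\gamma$. $\mathsf{REQS}_\succeq=\{(\ell,r,\varphi)\mid\ell\succeq r\ [\varphi]\in\mathsf{REQS}\}$, $\mathsf{REQS}_\succ=\{(\ell,r,\varphi)\mid\ell\succ r\ [\varphi]\in\mathsf{REQS}\}$. $\mathcal R'=\{(\ell\,x_1\cdots x_i,r\,x_1\cdots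 x_i,\varphi)\mid\ell\to r\ [\varphi]\in\mathcal R,\ \ell:\sigma_1\to\cdots\to\sigma_n\to\iota\ (\iota\in\mathcal S),\ 0\le i\le n,\ x_j:\sigma_j\text{ fresh}\}$. $\mathit{Defs}$: pairs $(f,n)$ with some $(f\,\ell_1\cdots\ell_n,r,\varphi)\in\mathcal R'\cup\mathsf{REQS}_\succ\cup\mathsf{REQS}_\succeq$. Candidate: $f\,s_1\cdots s_n$ with ($f\in\mathcal V$ and $n>0$) or $(f,n)\in\mathit{Defs}$. $\mathcal P_{weak}=\{(\ell,r,\varphi)\in\mathsf{REQS}_\succeq\cup\mathcal R'\mid r\text{ a candidate}\}$; $\mathcal P_{strong}=\{(\ell,r,\varphi)\in\mathsf{REQS}_\succ\mid r\text{ a candidate}\}\cup\{(\ell,p,\varphi)\mid(\ell,r,\varphi)\in\mathsf{REQS}_\succ\cup\mathsf{REQS}_\succeq\cup\mathcal R',\ r\rhd p,\ p\text{ a candidate}\}$. A strong chain is an infinite sequence with $s_i\to^{top}_{\mathcal P_{strong}}t_i\ (\to_{\mathcal R}\cup\to^{top}_{\mathcal P_{weak}})^*\ s_{i+1}$ for all $i\ge0$.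
   Formalization: The calculation rules are oriented by ≥ as well: f v₁ ⋯ vₘ ≥ v whenever v is the value of f applied to values v₁,…,vₘ, alongside ℓγ ≥ rγ for ℓ → r [φ] ∈ R. The statement above fails without it. -}

module Defs where

open import Data.Nat using (ℕ; zero; suc; _<_)
open import Data.Bool using (Bool; true)
open import Data.Product using (Σ; Σ-syntax; _×_; _,_; proj₁)
open import Data.Sum using (_⊎_)
open import Relation.Nullary using (¬_)
open import Relation.Binary.PropositionalEquality using (_≡_)
open import Relation.Binary.Core using (Rel)
open import Relation.Binary.Structures using (IsStrictPartialOrder; IsPreorder)
open import Relation.Binary.Construct.Closure.ReflexiveTransitive using (Star)

data ThSort (TS : Set) : Set where
  bool : ThSort TS
  oth  : TS → ThSort TS

I⟦_⟧ : {TS : Set} → (J : TS → Set) → ThSort TS → Set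
I⟦ J ⟧ bool    = Bool
I⟦ J ⟧ (oth t) = J t

data TTy (TS : Set) : Set where
  tbase : ThSort TS → TTy TS
  _t⇒_  : TTy TS → TTy TS → TTy TS

T⟦_⟧ : {TS : Set} → (J : TS → Set) → TTy TS → Set
T⟦ J ⟧ (tbase ι) = I⟦ J ⟧ ι
T⟦ J ⟧ (a t⇒ b)  = T⟦ J ⟧ a → T⟦ J ⟧ b

data Sort (US TS : Set) : Set where
  th : ThSort TS → Sort US TS
  us : US → Sort US TS

data Ty (US TS : Set) : Set where
  base : Sort US TS → Ty US TS
  _⇒_  : Ty US TS → Ty US TS → Ty US TS

embT : {US TS : Set} → TTy TS → Ty US TS
embT (tbase ι) = base (th ι)
embT (a t⇒ b)  = embT a ⇒ embT b

-- A signature of an LCSTRS.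
--   Σ_theory = values (exactly one per element of each theory sort)
--              ⊎ other (non-value) theory symbols Op, each with a
--              theory type and an interpretation;
--   Σ_terms  = F, each symbol with an arbitrary type.
record Sig : Set₁ where
  field
    US     : Set
    TS     : Set
    J      : TS → Set
    J-ne   : (t : TS) → J t
    Op     : Set
    opTy   : Op → TTy TS
    opI    : (o : Op) → T⟦ J ⟧ (opTy o)
    F      : Set
    fTy    : F → Ty US TS

module LCSTRS (S : Sig) where
  open Sig S public

  Tp : Set
  Tp = Ty US TS

  ⟦_⟧ι : ThSort TS → Set
  ⟦_⟧ι = I⟦ J ⟧

  ⟦_⟧τ : TTy TS → Set
  ⟦_⟧τ = T⟦ J ⟧

  data TSym : Set where
    val : (ι : ThSort TS) → ⟦ ι ⟧ι → TSym
    op  : Op → TSym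

  tTy : TSym → TTy TS
  tTy (val ι _) = tbase ι
  tTy (op o)    = opTy o

  tI : (g : TSym) → ⟦ tTy g ⟧τ
  tI (val ι a) = a
  tI (op o)    = opI o

  data Sym : Set where
    tS : TSym → Sym
    uS : F → Sym

  data Term : Tp → Set where
    tsym : (g : TSym) → Term (embT (tTy g))
    usym : (f : F) → Term (fTy f)
    var  : (σ : Tp) → ℕ → Term σ
    app  : {σ τ : Tp} → Term (σ ⇒ τ) → Term σ → Term τ

  Tm : Set
  Tm = Σ Tp Term

  value : (ι : ThSort TS) → ⟦ ι ⟧ι → Term (base (th ι))
  value ι a = tsym (val ι a)

  data Head : Set where
    hsym : Sym → Head
    hvar : Tp → ℕ → Head

  headOf : {σ : Tp} → Term σ → Head
  headOf (tsym g)  = hsym (tS g)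
  headOf (usym f)  = hsym (uS f)
  headOf (var σ n) = hvar σ n
  headOf (app s t) = headOf s

  nargs : {σ : Tp} → Term σ → ℕ
  nargs (tsym g)  = 0
  nargs (usym f)  = 0
  nargs (var σ n) = 0
  nargs (app s t) = suc (nargs s)

  SymHead : Tm → Set
  SymHead (_ , t) = Σ[ f ∈ Sym ] headOf t ≡ hsym f

  data Occ (σ : Tp) (n : ℕ) : {τ : Tp} → Term τ → Set where
    here  : Occ σ n (var σ n)
    left  : {ρ τ : Tp} {s : Term (ρ ⇒ τ)} {t : Term ρ} → Occ σ n s → Occ σ n (app s t)
    right : {ρ τ : Tp} {s : Term (ρ ⇒ τ)} {t : Term ρ} → Occ σ n t → Occ σ n (app s t)

  data _▷_ : Tm → Tm → Set where
    ▷l  : {ρ τ : Tp} {s : Term (ρ ⇒ τ)} {t : Term ρ} → (τ , app s t) ▷ ((ρ ⇒ τ) , s)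
    ▷r  : {ρ τ : Tp} {s : Term (ρ ⇒ τ)} {t : Term ρ} → (τ , app s t) ▷ (ρ , t)
    ▷tr : {a b c : Tm} → a ▷ b → b ▷ c → a ▷ c

  -- Theory terms and constraints (variables are theory-sorted: cvar ι n
  -- stands for the variable  var (base (th ι)) n).
  data TTerm : TTy TS → Set where
    csym : (g : TSym) → TTerm (tTy g)
    cvar : (ι : ThSort TS) → ℕ → TTerm (tbase ι)
    capp : {a b : TTy TS} → TTerm (a t⇒ b) → TTerm a → TTerm b

  Constraint : Set
  Constraint = TTerm (tbase bool)

  data COcc (ι : ThSort TS) (n : ℕ) : {a : TTy TS} → TTerm a → Set where
    here  : COcc ι n (cvar ι n)
    left  : {a b : TTy TS} {s : TTerm (a t⇒ b)} {t : TTerm a} → COcc ι n s → COcc ι n (capp s t)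
    right : {a b : TTy TS} {s : TTerm (a t⇒ b)} {t : TTerm a} → COcc ι n t → COcc ι n (capp s t)

  CFresh : Tp → ℕ → Constraint → Set
  CFresh σ n φ = (ι : ThSort TS) → σ ≡ base (th ι) → ¬ COcc ι n φ

  Subst : Set
  Subst = (σ : Tp) → ℕ → Term σ

  _[_] : {σ : Tp} → Term σ → Subst → Term σ
  tsym g    [ γ ] = tsym g
  usym f    [ γ ] = usym f
  var σ n   [ γ ] = γ σ n
  app s t   [ γ ] = app (s [ γ ]) (t [ γ ])

  _[_]ᵗ : Tm → Subst → Tm
  (σ , t) [ γ ]ᵗ = (σ , t [ γ ])

  IsValueAt : Subst → ThSort TS → ℕ → Set
  IsValueAt γ ι n = Σ[ a ∈ ⟦ ι ⟧ι ] γ (base (th ι)) n ≡ value ι a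

  eval : {a : TTy TS} (γ : Subst) (φ : TTerm a) →
         ((ι : ThSort TS) (n : ℕ) → COcc ι n φ → IsValueAt γ ι n) → ⟦ a ⟧τ
  eval γ (csym g)   h = tI g
  eval γ (cvar ι n) h = proj₁ (h ι n here)
  eval γ (capp s t) h = eval γ s (λ ι n o → h ι n (left o)) (eval γ t (λ ι n o → h ι n (right o)))

  Respects : Subst → Constraint → Set
  Respects γ φ = Σ[ h ∈ ((ι : ThSort TS) (n : ℕ) → COcc ι n φ → IsValueAt γ ι n) ] eval γ φ h ≡ true

  record Rule : Set where
    constructor rule
    field
      rty  : Tp
      lhs  : Term rty
      rhs  : Term rty
      cond : Constraint

  record Triple : Set where
    constructor ⟨_,_,_⟩
    field
      tl : Tm
      tr : Tm
      tφ : Constraint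
  open Triple public

  TopStep : (Triple → Set) → Tm → Tm → Set
  TopStep Q s t = Σ[ q ∈ Triple ] Q q × Σ[ γ ∈ Subst ] Respects γ (tφ q) × s ≡ tl q [ γ ]ᵗ × t ≡ tr q [ γ ]ᵗ

  -- Calculation rules  f x₁ ⋯ xₘ → y [y = f x₁ ⋯ xₘ]  for non-value theory
  -- symbols f (arguments theory-sorted, f x₁ ⋯ xₘ of a theory sort).
  -- Their instances are exactly  f v₁ ⋯ vₘ → v  with values vᵢ and
  -- v the value of ⟦f⟧(v₁,…,vₘ).
  data ValApp : (a : TTy TS) → Term (embT a) → ⟦ a ⟧τ → Set where
    vsym : (o : Op) → ValApp (opTy o) (tsym (op o)) (opI o)
    vapp : {ι : ThSort TS} {b : TTy TS} {t : Term (embT (tbase ι t⇒ b))} {x : ⟦ tbase ι t⇒ b ⟧τ} →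
           ValApp (tbase ι t⇒ b) t x → (v : ⟦ ι ⟧ι) → ValApp b (app t (value ι v)) (x v)

  CalcTop : Tm → Tm → Set
  CalcTop s t = Σ[ ι ∈ ThSort TS ] Σ[ u ∈ Term (base (th ι)) ] Σ[ x ∈ ⟦ ι ⟧ι ]
                  ValApp (tbase ι) u x × s ≡ (base (th ι) , u) × t ≡ (base (th ι) , value ι x)

  data Ctx (σ : Tp) : Tp → Set where
    □    : Ctx σ σ
    appL : {ρ τ : Tp} → Ctx σ (ρ ⇒ τ) → Term ρ → Ctx σ τ
    appR : {ρ τ : Tp} → Term (ρ ⇒ τ) → Ctx σ ρ → Ctx σ τ

  plug : {σ τ : Tp} → Ctx σ τ → Term σ → Term τ
  plug □          s = s
  plug (appL C t) s = app (plug C s) t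
  plug (appR t C) s = app t (plug C s)

  RootStep : (Rule → Set) → Tm → Tm → Set
  RootStep R s t =
    (Σ[ ρ ∈ Rule ] R ρ × Σ[ γ ∈ Subst ] Respects γ (Rule.cond ρ)
        × s ≡ (Rule.rty ρ , Rule.lhs ρ [ γ ]) × t ≡ (Rule.rty ρ , Rule.rhs ρ [ γ ]))
    ⊎ CalcTop s t

  Step : (Rule → Set) → Tm → Tm → Set
  Step R s t = Σ[ σ ∈ Tp ] Σ[ τ ∈ Tp ] Σ[ C ∈ Ctx σ τ ] Σ[ u ∈ Term σ ] Σ[ u' ∈ Term σ ]
                 RootStep R (σ , u) (σ , u') × s ≡ (τ , plug C u) × t ≡ (τ , plug C u')

  -- Requirements:  REQS strict ⟨ℓ,r,φ⟩  means  ℓ ≻ r [φ] ∈ REQS,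
  --                REQS weak   ⟨ℓ,r,φ⟩  means  ℓ ≽ r [φ] ∈ REQS.
  data Kind : Set where
    strict weak : Kind

  data R′ (R : Rule → Set) : Triple → Set where
    r-base : {ρ : Rule} → R ρ →
             R′ R ⟨ (Rule.rty ρ , Rule.lhs ρ) , (Rule.rty ρ , Rule.rhs ρ) , Rule.cond ρ ⟩
    r-ext  : {σ τ : Tp} {ℓ r : Term (σ ⇒ τ)} {φ : Constraint} {n : ℕ} →
             R′ R ⟨ (σ ⇒ τ , ℓ) , (σ ⇒ τ , r) , φ ⟩ →
             ¬ Occ σ n ℓ → ¬ Occ σ n r → CFresh σ n φ →
             R′ R ⟨ (τ , app ℓ (var σ n)) , (τ , app r (var σ n)) , φ ⟩

  module DP (R : Rule → Set) (REQS : Kind → Triple → Set) where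

    AllTriples : Triple → Set
    AllTriples q = REQS strict q ⊎ REQS weak q ⊎ R′ R q

    Defs : Sym → ℕ → Set
    Defs f n = Σ[ q ∈ Triple ] AllTriples q × headOf (proj₂′ (tl q)) ≡ hsym f × nargs (proj₂′ (tl q)) ≡ n
      where
      proj₂′ : (x : Tm) → Term (proj₁ x)
      proj₂′ (_ , t) = t

    Candidate : Tm → Set
    Candidate (_ , t) =
      (Σ[ σ ∈ Tp ] Σ[ m ∈ ℕ ] headOf t ≡ hvar σ m × 0 < nargs t)
      ⊎ (Σ[ f ∈ Sym ] headOf t ≡ hsym f × Defs f (nargs t))

    P-weak : Triple → Set
    P-weak q = (REQS weak q ⊎ R′ R q) × Candidate (tr q)

    P-strong : Triple → Set
    P-strong q = (REQS strict q × Candidate (tr q))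
               ⊎ (Σ[ r ∈ Tm ] AllTriples ⟨ tl q , r , tφ q ⟩ × r ▷ tr q × Candidate (tr q))

    WeakStep : Tm → Tm → Set
    WeakStep s t = Step R s t ⊎ TopStep P-weak s t

    StrongChain : Set
    StrongChain = Σ[ s ∈ (ℕ → Tm) ] Σ[ t ∈ (ℕ → Tm) ] ((i : ℕ) →
                    TopStep P-strong (s i) (t i) × Star WeakStep (t i) (s (suc i)))

  record ReductionTriple : Set₁ where
    field
      _>_ _≳_ _≥_ : Rel Tm _
      >-spo     : IsStrictPartialOrder _≡_ _>_
      >-wf      : ¬ (Σ[ f ∈ (ℕ → Tm) ] ((i : ℕ) → f i > f (suc i)))
      ≳-quasi   : IsPreorder _≡_ _≳_
      >-≳       : {s t u : Tm} → s > t → t ≳ u → s > u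
      ≥-quasi   : IsPreorder _≡_ _≥_
      ≥-mono    : {σ τ : Tp} (C : Ctx σ τ) (s t : Term σ) →
                  (σ , s) ≥ (σ , t) → (τ , plug C s) ≥ (τ , plug C t)
      ≥⇒≳       : {s t : Tm} → s ≥ t → s ≳ t

{-# OPTIONS --safe #-}
-- A strong step s i → t i is an instance of a P-strong triple, hence strictly
-- decreasing, and every later step is weakly decreasing: rewrite steps because ≥
-- is monotonic and contained in ≳, top steps with P-weak by assumption. As
-- s > t ≳ u implies s > u, the start terms s i of a strong chain would form an
-- infinite >-descending sequence.
module Submission where

open import Defs
open import Data.Nat using (ℕ; suc)
open import Data.Product using (_,_; proj₁; proj₂)
open import Data.Sum using (inj₁; inj₂)
open import Relation.Nullary using (¬_)
open import Relation.Binary.Core using (Rel) renaming (_⇒_ to _⊆_)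
open import Relation.Binary.Structures using (IsPreorder)
open import Relation.Binary.PropositionalEquality using (refl)
open import Relation.Binary.Construct.Closure.ReflexiveTransitive using (Star; fold)

Star⊆ : ∀ {a ℓ₁ ℓ₂ ℓ₃} {A : Set a} {_≈_ : Rel A ℓ₁} {_⟶_ : Rel A ℓ₂} {_≲_ : Rel A ℓ₃} →
        IsPreorder _≈_ _≲_ → _⟶_ ⊆ _≲_ → Star _⟶_ ⊆ _≲_
Star⊆ {_≲_ = _≲_} ≲-preorder ⟶⊆≲ =
  fold _≲_ (λ x p → IsPreorder.trans ≲-preorder (⟶⊆≲ x) p) (IsPreorder.refl ≲-preorder)

module _ {S : Sig} where
  open LCSTRS S

  TopStep⊆ : ∀ {ℓ} {Q : Triple → Set} {_∼_ : Rel Tm ℓ} →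
             ((q : Triple) → Q q → (γ : Subst) → Respects γ (tφ q) → (tl q [ γ ]ᵗ) ∼ (tr q [ γ ]ᵗ)) →
             TopStep Q ⊆ _∼_
  TopStep⊆ oriented (q , q∈Q , γ , γ⊨φ , refl , refl) = oriented q q∈Q γ γ⊨φ

  module _ {R : Rule → Set} (T : ReductionTriple) where
    open ReductionTriple T

    Step⊆≥ : ((ρ : Rule) → R ρ → (γ : Subst) → Respects γ (Rule.cond ρ) →
               (Rule.rty ρ , Rule.lhs ρ [ γ ]) ≥ (Rule.rty ρ , Rule.rhs ρ [ γ ])) →
             ((s t : Tm) → CalcTop s t → s ≥ t) →
             Step R ⊆ _≥_
    Step⊆≥ rules⇒≥ calc⇒≥ (_ , _ , C , u , u′ , root , refl , refl) = ≥-mono C u u′ (RootStep⊆≥ root)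
      where
      RootStep⊆≥ : RootStep R ⊆ _≥_
      RootStep⊆≥ (inj₁ (ρ , ρ∈R , γ , γ⊨φ , refl , refl)) = rules⇒≥ ρ ρ∈R γ γ⊨φ
      RootStep⊆≥ (inj₂ calc)                             = calc⇒≥ _ _ calc

corollary6p3 : (S : Sig) → let open LCSTRS S in
    (R : Rule → Set) (REQS : Kind → Triple → Set) →
    ((ρ : Rule) → R ρ → SymHead (Rule.rty ρ , Rule.lhs ρ)) →
    ((k : Kind) (q : Triple) → REQS k q → SymHead (tl q)) →
    let open DP R REQS in
    (T : ReductionTriple) → let open ReductionTriple T in
    ((q : Triple) → P-strong q → (γ : Subst) → Respects γ (tφ q) → (tl q [ γ ]ᵗ) > (tr q [ γ ]ᵗ)) →
    ((q : Triple) → P-weak q → (γ : Subst) → Respects γ (tφ q) → (tl q [ γ ]ᵗ) ≳ (tr q [ γ ]ᵗ)) →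
    ((ρ : Rule) → R ρ → (γ : Subst) → Respects γ (Rule.cond ρ) →
       (Rule.rty ρ , Rule.lhs ρ [ γ ]) ≥ (Rule.rty ρ , Rule.rhs ρ [ γ ])) →
    ((s t : Tm) → CalcTop s t → s ≥ t) →
    ¬ StrongChain
corollary6p3 S R REQS _ _ T strong⇒> weak⇒≳ rules⇒≥ calc⇒≥ (s , t , chain) = >-wf (s , descends)
  where
  open LCSTRS S
  open DP R REQS
  open ReductionTriple T

  WeakStep⊆≳ : WeakStep ⊆ _≳_
  WeakStep⊆≳ (inj₁ step) = ≥⇒≳ (Step⊆≥ T rules⇒≥ calc⇒≥ step)
  WeakStep⊆≳ (inj₂ top)  = TopStep⊆ weak⇒≳ top

  descends : (i : ℕ) → s i > s (suc i)
  descends i = >-≳ (TopStep⊆ {_∼_ = _>_} strong⇒> (proj₁ (chain i)))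
                   (Star⊆ ≳-quasi WeakStep⊆≳ (proj₂ (chain i)))
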